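{- Let $0<\varepsilon\le1$, $\alpha\ge1$, let $d_X\ge3$ be an integer, and let $\phi>0$. Let $G=(V,E)$ be a simple graph, let $L$ and $R$ be disjoint new vertex sets with $|L|=|R|=N$, and let $G_{exp}$ be the graph on $V\cup L\cup R$ whose edges are $E$, a set of edges between $V$ and $L$, and the edges of a bipartite graph $X$ with sides $L$ and $R$, such that: (1) every $v\in V$ has at least $\varepsilon\deg_G(v)+1$ neighbors in $L$; (2) $X$ is $d_X$-regular and a $\phi d_X$-edge expander; (3) every vertex of $L$ has degree in $G_{exp}$ within $[d_X,\alpha d_X]$. Then $G_{exp}$ is a $\phi\varepsilon/(5\alpha)$-expander.
   Context: For a graph $H$ and $S\subseteq V(H)$: $\mathrm{vol}(S)=\sum_{v\in S}\deg(v)$; $e(S,V\setminus S)$ is the number of edges with exactly one endpoint in $S$; $\phi(S)=e(S,V\setminus S)/\min(\mathrm{vol}(S),\mathrm{vol}(V\setminus S))$, defined as $0$ if the minimum is $0$; $\phi_H=\min_{\emptyset\ne S\subsetneq V(H)}\phi(S)$; $H$ is a $c$-expander if $\phi_H\ge c$. The edge expansion of an $n'$-vertex graph $H$ is $h_H=\min_{\emptyset\ne S,\ |S|\le n'/2} e(S,V\setminus S)/|S|$, and $H$ is an $h$-edge expander if $h_H\ge h$.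
   Formalization: The parameters ε, α and φ take rational values. -}

module Defs where

open import Data.Nat as ℕ using (ℕ; zero; suc; _+_)
open import Data.Bool using (Bool; true; false; if_then_else_; not; _∧_)
open import Data.Fin using (Fin; splitAt; _↑ˡ_; _↑ʳ_)
open import Data.Sum using (_⊎_; inj₁; inj₂)
open import Data.List using (List; map; allFin)
open import Data.Nat.ListAction using (sum)
open import Data.Integer using (+_)
open import Data.Rational using (ℚ; _/_; 0ℚ; 1ℚ; _≤_; _<_; _*_; _÷_; NonZero; >-nonZero; positive)
open import Data.Rational.Properties using (<-≤-trans; positive⁻¹; pos*pos⇒pos)
open import Relation.Binary.PropositionalEquality using (_≡_)
open import Relation.Nullary.Decidable using (toWitness)
import Data.Rational.Properties as ℚP

ℕ→ℚ : ℕ → ℚ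
ℕ→ℚ k = (+ k) / 1

count : ∀ {m} → (Fin m → Bool) → ℕ
count {m} f = sum (map (λ v → if f v then 1 else 0) (allFin m))

record SimpleGraph (m : ℕ) : Set where
  field
    adj    : Fin m → Fin m → Bool
    sym    : ∀ u v → adj u v ≡ adj v u
    noLoop : ∀ v → adj v v ≡ false
open SimpleGraph public

Adj : ℕ → Set
Adj m = Fin m → Fin m → Bool

Subset : ℕ → Set
Subset m = Fin m → Bool

deg : ∀ {m} → Adj m → Fin m → ℕ
deg A v = count (A v)

vol : ∀ {m} → Adj m → Subset m → ℕ
vol {m} A S = sum (map (λ v → if S v then deg A v else 0) (allFin m))

compl : ∀ {m} → Subset m → Subset m
compl S v = not (S v)

cut : ∀ {m} → Adj m → Subset m → ℕ
cut {m} A S = sum (map (λ u → if S u then count (λ v → A u v ∧ not (S v)) else 0) (allFin m))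

-- a / b as a rational, defined as 0 when b = 0
ratio : ℕ → ℕ → ℚ
ratio a zero    = 0ℚ
ratio a (suc b) = (+ a) / suc b

-- φ(S) = e(S, V∖S) / min(vol S, vol (V∖S)), 0 if the minimum is 0
conductance : ∀ {m} → Adj m → Subset m → ℚ
conductance A S = ratio (cut A S) (ℕ._⊓_ (vol A S) (vol A (compl S)))

IsExpander : ∀ {m} → Adj m → ℚ → Set
IsExpander {m} A c = ∀ (S : Subset m) → ℕ._<_ 0 (count S) → ℕ._<_ (count S) m →
  c ≤ conductance A S

IsEdgeExpander : ∀ {m} → Adj m → ℚ → Set
IsEdgeExpander {m} A h = ∀ (S : Subset m) → ℕ._<_ 0 (count S) → ℕ._≤_ (2 ℕ.* count S) m →
  h ≤ ratio (cut A S) (count S)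

IsRegular : ∀ {m} → Adj m → ℕ → Set
IsRegular {m} A d = ∀ (v : Fin m) → deg A v ≡ d

-- The construction G_exp on V ∪ L ∪ R, with V = Fin n, L = R = Fin N,
-- vertex order: V first, then L, then R  (Fin (n + (N + N))).

data Side (n N : ℕ) : Set where
  inV : Fin n → Side n N
  inL : Fin N → Side n N
  inR : Fin N → Side n N

side : ∀ n N → Fin (n + (N + N)) → Side n N
side n N u with splitAt n u
... | inj₁ a = inV a
... | inj₂ w with splitAt N w
...   | inj₁ i = inL i
...   | inj₂ j = inR j

vL : ∀ n N → Fin N → Fin (n + (N + N))
vL n N i = n ↑ʳ (i ↑ˡ N)

-- X: bipartite graph with sides L and R, given by X i j = [L_i ~ R_j];
-- as a graph on L ∪ R = Fin (N + N) (L first, then R)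
bipAdj : ∀ N → (Fin N → Fin N → Bool) → Adj (N + N)
bipAdj N X u v with splitAt N u | splitAt N v
... | inj₁ i | inj₂ j = X i j
... | inj₂ j | inj₁ i = X i j
... | _      | _      = false

-- G_exp: edges of G, the V–L edges B (B a i = [v_a ~ L_i]), and the edges of X
expAdjSide : ∀ {n N} → Adj n → (Fin n → Fin N → Bool) → (Fin N → Fin N → Bool) →
  Side n N → Side n N → Bool
expAdjSide G B X (inV a) (inV b) = G a b
expAdjSide G B X (inV a) (inL i) = B a i
expAdjSide G B X (inL i) (inV a) = B a i
expAdjSide G B X (inL i) (inR j) = X i j
expAdjSide G B X (inR j) (inL i) = X i j
expAdjSide G B X _       _       = false

expAdj : ∀ n N → Adj n → (Fin n → Fin N → Bool) → (Fin N → Fin N → Bool) →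
  Adj (n + (N + N))
expAdj n N G B X u v = expAdjSide G B X (side n N u) (side n N v)

5ℚ : ℚ
5ℚ = (+ 5) / 1

5α-nonZero : ∀ α → 1ℚ ≤ α → NonZero (5ℚ * α)
5α-nonZero α 1≤α = >-nonZero (positive⁻¹ (5ℚ * α) {{pos*pos⇒pos 5ℚ α {{αpos}}}})
  where
  0<1 : 0ℚ < 1ℚ
  0<1 = toWitness {a? = 0ℚ ℚP.<? 1ℚ} _
  αpos = positive (<-≤-trans 0<1 1≤α)

bound : (ϕ ε α : ℚ) → 1ℚ ≤ α → ℚ
bound ϕ ε α 1≤α = _÷_ (ϕ * ε) (5ℚ * α) {{5α-nonZero α 1≤α}}

-- Let T be a vertex set and A = T ∩ (L ∪ R). Since cut(T) = cut(V ∖ T), we may replace T by its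
-- complement and assume |A| ≤ N. A vertex a ∈ V has ε·deg(a) ≤ 2·|B a| by (1), and each V–L edge at
-- a ∈ T either leaves T or ends in A, where it is counted in vol(A); hence
-- ε·vol(T) ≤ 2·e(T ∩ V, L ∖ T) + 3·vol(A). Every vertex of L ∪ R has degree at most α·d_X, so
-- vol(A) ≤ α·d_X·|A| ≤ (α/ϕ)·e_X(A, (L ∪ R) ∖ A) by the expansion of X. Both kinds of edges are cut
-- edges of T, and ϕ ≤ 1 (the expansion of a regular graph is at most its degree), so
-- ϕε·vol(T) ≤ 5α·cut(T).
module Submission where

open import Defs hiding (sym)
open import Data.Nat as ℕ using (ℕ; zero; suc; _+_; _≤_; z≤n; s≤s)
import Data.Nat.Properties as ℕP
open import Data.Bool using (Bool; true; false; if_then_else_; not; _∧_)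
open import Data.Bool.Properties using (∧-zeroʳ)
open import Data.Fin as Fin using (Fin; splitAt; _↑ˡ_; _↑ʳ_)
open import Data.Fin.Properties using (splitAt-↑ˡ; splitAt-↑ʳ; splitAt⁻¹-↑ˡ; splitAt⁻¹-↑ʳ)
open import Data.Sum using (inj₁; inj₂)
open import Data.List using (map; allFin; tabulate)
import Data.Nat.ListAction as List
import Data.Integer as ℤ
import Data.Integer.Properties as ℤP
open import Data.Rational as ℚ using (ℚ; 0ℚ; 1ℚ; mkℚ)
import Data.Rational.Properties as ℚP
import Data.Nat.Coprimality as C
open import Data.Rational.Unnormalised as ℚᵘ using (mkℚᵘ)
import Data.Rational.Unnormalised.Properties as ℚᵘP
open import Data.Integer.Solver using () renaming (module +-*-Solver to ℤ-Solver)
open import Data.Rational.Solver using () renaming (module +-*-Solver to ℚ-Solver)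
open import Data.Nat.Solver using () renaming (module +-*-Solver to ℕ-Solver)
open import Algebra.Properties.CommutativeMonoid.Sum ℕP.+-0-commutativeMonoid
  using (sum; sum-cong-≗; sum-replicate-zero; ∑-distrib-+; ∑-comm)
open import Algebra.Properties.Semiring.Sum ℕP.+-*-semiring using (*-distribˡ-sum)
open import Relation.Nullary using (does; yes; no)
open import Relation.Binary.PropositionalEquality
open import Data.Empty using (⊥-elim)

_when_ : ℕ → Bool → ℕ
x when b = if b then x else 0

when-mono : ∀ b {x y} → x ≤ y → x when b ≤ y when b
when-mono true  x≤y = x≤y
when-mono false _   = z≤n

when-distrib-+ : ∀ b x y → (x + y) when b ≡ x when b + y when b
when-distrib-+ true  x y = refl
when-distrib-+ false x y = refl

splitAt-elim : ∀ {n k} (P : Fin (n + k) → Set) →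
  (∀ a → P (a ↑ˡ k)) → (∀ w → P (n ↑ʳ w)) → ∀ u → P u
splitAt-elim {n} P left right u with splitAt n u in eq
... | inj₁ a = subst P (splitAt⁻¹-↑ˡ eq) (left a)
... | inj₂ w = subst P (splitAt⁻¹-↑ʳ eq) (right w)

sum-allFin : ∀ {m} (f : Fin m → ℕ) → List.sum (map f (allFin m)) ≡ sum f
sum-allFin {m} f = sum-map-tabulate (λ i → i)
  where
  sum-map-tabulate : ∀ {k} (g : Fin k → Fin m) → List.sum (map f (tabulate g)) ≡ sum (λ i → f (g i))
  sum-map-tabulate {zero}  g = refl
  sum-map-tabulate {suc k} g = cong (f (g Fin.zero) +_) (sum-map-tabulate (λ i → g (Fin.suc i)))

sum-mono : ∀ {m} {f g : Fin m → ℕ} → (∀ i → f i ≤ g i) → sum f ≤ sum g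
sum-mono {zero}  f≤g = z≤n
sum-mono {suc m} f≤g = ℕP.+-mono-≤ (f≤g Fin.zero) (sum-mono (λ i → f≤g (Fin.suc i)))

sum-↑ : ∀ n {k} (f : Fin (n + k) → ℕ) → sum f ≡ sum (λ a → f (a ↑ˡ k)) + sum (λ w → f (n ↑ʳ w))
sum-↑ zero    f = refl
sum-↑ (suc n) f = trans (cong (f Fin.zero +_) (sum-↑ n (λ i → f (Fin.suc i))))
  (sym (ℕP.+-assoc (f Fin.zero) _ _))

count≡sum : ∀ {m} (f : Subset m) → count f ≡ sum (λ v → 1 when f v)
count≡sum f = sum-allFin (λ v → 1 when f v)

count-cong : ∀ {m} {f g : Subset m} → (∀ v → f v ≡ g v) → count f ≡ count g
count-cong {f = f} {g} f≗g = begin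
  count f                     ≡⟨ count≡sum f ⟩
  sum (λ v → 1 when f v)      ≡⟨ sum-cong-≗ (λ v → cong (1 when_) (f≗g v)) ⟩
  sum (λ v → 1 when g v)      ≡⟨ count≡sum g ⟨
  count g                     ∎
  where open ≡-Reasoning

count-false : ∀ m → count {m} (λ _ → false) ≡ 0
count-false m = trans (count≡sum {m} (λ _ → false)) (sum-replicate-zero m)

count-↑ : ∀ n {k} (f : Subset (n + k)) →
  count f ≡ count (λ a → f (a ↑ˡ k)) + count (λ w → f (n ↑ʳ w))
count-↑ n {k} f = begin
  count f
    ≡⟨ count≡sum f ⟩
  sum (λ v → 1 when f v)
    ≡⟨ sum-↑ n (λ v → 1 when f v) ⟩
  sum (λ a → 1 when f (a ↑ˡ k)) + sum (λ w → 1 when f (n ↑ʳ w))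
    ≡⟨ cong₂ _+_ (count≡sum (λ a → f (a ↑ˡ k))) (count≡sum (λ w → f (n ↑ʳ w))) ⟨
  count (λ a → f (a ↑ˡ k)) + count (λ w → f (n ↑ʳ w))                ∎
  where open ≡-Reasoning

count-∧-split : ∀ {m} (f g : Subset m) →
  count f ≡ count (λ v → f v ∧ g v) + count (λ v → f v ∧ not (g v))
count-∧-split f g = begin
  count f                                                        ≡⟨ count≡sum f ⟩
  sum (λ v → 1 when f v)                                         ≡⟨ sum-cong-≗ (λ v → split (f v) (g v)) ⟩
  sum (λ v → 1 when (f v ∧ g v) + 1 when (f v ∧ not (g v)))
    ≡⟨ ∑-distrib-+ (λ v → 1 when (f v ∧ g v)) (λ v → 1 when (f v ∧ not (g v))) ⟩
  sum (λ v → 1 when (f v ∧ g v)) + sum (λ v → 1 when (f v ∧ not (g v)))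
    ≡⟨ cong₂ _+_ (count≡sum (λ v → f v ∧ g v)) (count≡sum (λ v → f v ∧ not (g v))) ⟨
  count (λ v → f v ∧ g v) + count (λ v → f v ∧ not (g v))        ∎
  where
  open ≡-Reasoning
  split : ∀ b c → 1 when b ≡ 1 when (b ∧ c) + 1 when (b ∧ not c)
  split false c     = refl
  split true  false = refl
  split true  true  = refl

count-∧-≤ : ∀ {m} (f g : Subset m) → count (λ v → f v ∧ g v) ≤ count f
count-∧-≤ f g = ℕP.≤-trans (ℕP.m≤m+n _ _) (ℕP.≤-reflexive (sym (count-∧-split f g)))

count-compl : ∀ {m} (S : Subset m) → count (compl S) + count S ≡ m
count-compl {m} S = begin
  count (compl S) + count S
    ≡⟨ cong₂ _+_ (count≡sum (compl S)) (count≡sum S) ⟩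
  sum (λ v → 1 when not (S v)) + sum (λ v → 1 when S v)
    ≡⟨ ∑-distrib-+ (λ v → 1 when not (S v)) (λ v → 1 when S v) ⟨
  sum (λ v → 1 when not (S v) + 1 when S v)
    ≡⟨ sum-cong-≗ (λ v → one (S v)) ⟩
  sum {m} (λ _ → 1)
    ≡⟨ ones m ⟩
  m                                                          ∎
  where
  open ≡-Reasoning
  one : ∀ b → 1 when not b + 1 when b ≡ 1
  one false = refl
  one true  = refl
  ones : ∀ m → sum {m} (λ _ → 1) ≡ m
  ones zero    = refl
  ones (suc m) = cong suc (ones m)

count-const-∧ : ∀ {m} b (f : Subset m) → count (λ v → b ∧ f v) ≡ count f when b
count-const-∧ {m} false f = count-false m
count-const-∧     true  f = refl

count-↑ˡ-≤ : ∀ n {k} (f : Subset (n + k)) → count (λ a → f (a ↑ˡ k)) ≤ count f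
count-↑ˡ-≤ n f = ℕP.≤-trans (ℕP.m≤m+n _ _) (ℕP.≤-reflexive (sym (count-↑ n f)))

count-↑ʳ-≤ : ∀ n {k} (f : Subset (n + k)) → count (λ w → f (n ↑ʳ w)) ≤ count f
count-↑ʳ-≤ n f = ℕP.≤-trans (ℕP.m≤n+m _ _) (ℕP.≤-reflexive (sym (count-↑ n f)))

sum-count-comm : ∀ {m k} (R : Fin m → Fin k → Bool) →
  sum (λ a → count (R a)) ≡ sum (λ w → count (λ a → R a w))
sum-count-comm R = begin
  sum (λ a → count (R a))                          ≡⟨ sum-cong-≗ (λ a → count≡sum (R a)) ⟩
  sum (λ a → sum (λ w → 1 when R a w))             ≡⟨ ∑-comm (λ a w → 1 when R a w) ⟩
  sum (λ w → sum (λ a → 1 when R a w))             ≡⟨ sum-cong-≗ (λ w → count≡sum (λ a → R a w)) ⟨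
  sum (λ w → count (λ a → R a w))                  ∎
  where open ≡-Reasoning

count-singleton : ∀ {m} (v : Fin m) → count (λ u → does (u Fin.≟ v)) ≡ 1
count-singleton v = trans (count≡sum (λ u → does (u Fin.≟ v))) (indicator v)
  where
  indicator : ∀ {m} (v : Fin m) → sum (λ u → 1 when does (u Fin.≟ v)) ≡ 1
  indicator {suc m} Fin.zero    = cong suc (sum-replicate-zero m)
  indicator {suc m} (Fin.suc v) = indicator v

compl-nonempty : ∀ {m} (S : Subset m) → count S ℕ.< m → 0 ℕ.< count (compl S)
compl-nonempty S |S|<m with count (compl S) | count-compl S
... | zero  | |S|≡m = ⊥-elim (ℕP.<-irrefl |S|≡m |S|<m)
... | suc _ | _     = s≤s z≤n

complement-small : ∀ {a b m} → b + a ≡ m → m ℕ.< 2 ℕ.* a → 2 ℕ.* b ≤ m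
complement-small {a} {b} {m} b+a≡m m<2a = ℕP.<⇒≤ (ℕP.+-cancelʳ-< m (2 ℕ.* b) m (begin-strict
  2 ℕ.* b + m         <⟨ ℕP.+-monoʳ-< (2 ℕ.* b) m<2a ⟩
  2 ℕ.* b + 2 ℕ.* a   ≡⟨ ℕP.*-distribˡ-+ 2 b a ⟨
  2 ℕ.* (b + a)       ≡⟨ cong (2 ℕ.*_) b+a≡m ⟩
  2 ℕ.* m             ≡⟨ cong (m +_) (ℕP.+-identityʳ m) ⟩
  m + m               ∎))
  where open ℕP.≤-Reasoning

IsSymmetric : ∀ {m} → Adj m → Set
IsSymmetric A = ∀ u v → A u v ≡ A v u

vol≡sum : ∀ {m} (A : Adj m) (S : Subset m) → vol A S ≡ sum (λ v → deg A v when S v)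
vol≡sum A S = sum-allFin (λ v → deg A v when S v)

cut≡sum : ∀ {m} (A : Adj m) (S : Subset m) →
  cut A S ≡ sum (λ u → count (λ v → A u v ∧ not (S v)) when S u)
cut≡sum A S = sum-allFin (λ u → count (λ v → A u v ∧ not (S v)) when S u)

cut-cong : ∀ {m} {A A′ : Adj m} → (∀ u v → A u v ≡ A′ u v) → (S : Subset m) → cut A S ≡ cut A′ S
cut-cong {A = A} {A′} A≗A′ S = begin
  cut A S
    ≡⟨ cut≡sum A S ⟩
  sum (λ u → count (λ v → A u v ∧ not (S v)) when S u)
    ≡⟨ sum-cong-≗ (λ u → cong (_when S u)
        (count-cong (λ v → cong (_∧ not (S v)) (A≗A′ u v)))) ⟩
  sum (λ u → count (λ v → A′ u v ∧ not (S v)) when S u)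
    ≡⟨ cut≡sum A′ S ⟨
  cut A′ S                                                ∎
  where open ≡-Reasoning

cut≤vol : ∀ {m} (A : Adj m) (S : Subset m) → cut A S ≤ vol A S
cut≤vol A S = begin
  cut A S
    ≡⟨ cut≡sum A S ⟩
  sum (λ u → count (λ v → A u v ∧ not (S v)) when S u)
    ≤⟨ sum-mono (λ u → when-mono (S u) (count-∧-≤ (A u) (λ v → not (S v)))) ⟩
  sum (λ u → deg A u when S u)
    ≡⟨ vol≡sum A S ⟨
  vol A S                                                ∎
  where open ℕP.≤-Reasoning

count≤vol : ∀ {m} (A : Adj m) → (∀ v → 1 ≤ deg A v) → (S : Subset m) → count S ≤ vol A S
count≤vol A deg≥1 S = begin
  count S                         ≡⟨ count≡sum S ⟩
  sum (λ v → 1 when S v)          ≤⟨ sum-mono (λ v → when-mono (S v) (deg≥1 v)) ⟩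
  sum (λ v → deg A v when S v)    ≡⟨ vol≡sum A S ⟨
  vol A S                         ∎
  where open ℕP.≤-Reasoning

cut-compl : ∀ {m} (A : Adj m) → IsSymmetric A → (S : Subset m) → cut A (compl S) ≡ cut A S
cut-compl A A-sym S = begin
  cut A (compl S)
    ≡⟨ as-double-sum (compl S) ⟩
  sum (λ u → count (λ v → not (S u) ∧ (A u v ∧ not (not (S v)))))
    ≡⟨ sum-count-comm (λ u v → not (S u) ∧ (A u v ∧ not (not (S v)))) ⟩
  sum (λ v → count (λ u → not (S u) ∧ (A u v ∧ not (not (S v)))))
    ≡⟨ sum-cong-≗ (λ v → count-cong (λ u → flip u v)) ⟩
  sum (λ v → count (λ u → S v ∧ (A v u ∧ not (S u))))
    ≡⟨ as-double-sum S ⟨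
  cut A S                                                           ∎
  where
  open ≡-Reasoning
  as-double-sum : ∀ S → cut A S ≡ sum (λ u → count (λ v → S u ∧ (A u v ∧ not (S v))))
  as-double-sum S = trans (cut≡sum A S) (sum-cong-≗ (λ u → sym (count-const-∧ (S u) (λ v → A u v ∧ not (S v)))))
  flip : ∀ u v → not (S u) ∧ (A u v ∧ not (not (S v))) ≡ S v ∧ (A v u ∧ not (S u))
  flip u v rewrite A-sym u v with S u | S v
  ... | false | false = ∧-zeroʳ (A v u)
  ... | false | true  = refl
  ... | true  | false = refl
  ... | true  | true  = sym (∧-zeroʳ (A v u))

vol-regular : ∀ {m} (A : Adj m) {d} → IsRegular A d → (S : Subset m) → vol A S ≡ d ℕ.* count S
vol-regular A {d} A-reg S = begin
  vol A S
    ≡⟨ vol≡sum A S ⟩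
  sum (λ v → deg A v when S v)
    ≡⟨ sum-cong-≗ (λ v → trans (cong (_when S v) (A-reg v)) (scale (S v))) ⟩
  sum (λ v → d ℕ.* (1 when S v))
    ≡⟨ *-distribˡ-sum d (λ v → 1 when S v) ⟨
  d ℕ.* sum (λ v → 1 when S v)
    ≡⟨ cong (d ℕ.*_) (count≡sum S) ⟨
  d ℕ.* count S                         ∎
  where
  open ≡-Reasoning
  scale : ∀ b → d when b ≡ d ℕ.* (1 when b)
  scale true  = sym (ℕP.*-identityʳ d)
  scale false = sym (ℕP.*-zeroʳ d)

-- The normal form of a natural number, on which ℚ's operations compute by evaluation.
ℕ→mkℚ : ℕ → ℚ
ℕ→mkℚ k = mkℚ (ℤ.+ k) 0 (C.sym (C.1-coprimeTo k))

ℕ→ℚ≡ℕ→mkℚ : ∀ k → ℕ→ℚ k ≡ ℕ→mkℚ k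
ℕ→ℚ≡ℕ→mkℚ k = ℚP.↥p/↧p≡p (ℕ→mkℚ k)

ℕ→ℚ-homo-+ : ∀ a b → ℕ→ℚ (a + b) ≡ ℕ→ℚ a ℚ.+ ℕ→ℚ b
ℕ→ℚ-homo-+ a b = begin
  ℕ→ℚ (a + b)                      ≡⟨ cong₂ (λ x y → ℕ→ℚ (x + y)) (ℕP.*-identityʳ a) (ℕP.*-identityʳ b) ⟨
  ℤ.+ (a ℕ.* 1 + b ℕ.* 1) ℚ./ 1    ≡⟨ mkℚ-+ a b ⟨
  ℕ→mkℚ a ℚ.+ ℕ→mkℚ b              ≡⟨ cong₂ ℚ._+_ (ℕ→ℚ≡ℕ→mkℚ a) (ℕ→ℚ≡ℕ→mkℚ b) ⟨
  ℕ→ℚ a ℚ.+ ℕ→ℚ b                  ∎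
  where
  open ≡-Reasoning
  mkℚ-+ : ∀ a b → ℕ→mkℚ a ℚ.+ ℕ→mkℚ b ≡ ℤ.+ (a ℕ.* 1 + b ℕ.* 1) ℚ./ 1
  mkℚ-+ zero    zero    = refl
  mkℚ-+ zero    (suc b) = refl
  mkℚ-+ (suc a) zero    = refl
  mkℚ-+ (suc a) (suc b) = refl

ℕ→ℚ-homo-* : ∀ a b → ℕ→ℚ (a ℕ.* b) ≡ ℕ→ℚ a ℚ.* ℕ→ℚ b
ℕ→ℚ-homo-* a b = trans (sym (mkℚ-* a b)) (cong₂ ℚ._*_ (sym (ℕ→ℚ≡ℕ→mkℚ a)) (sym (ℕ→ℚ≡ℕ→mkℚ b)))
  where
  mkℚ-* : ∀ a b → ℕ→mkℚ a ℚ.* ℕ→mkℚ b ≡ ℕ→ℚ (a ℕ.* b)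
  mkℚ-* zero    zero    = refl
  mkℚ-* zero    (suc b) = refl
  mkℚ-* (suc a) zero    rewrite ℕP.*-zeroʳ a = refl
  mkℚ-* (suc a) (suc b) = refl

ℕ→ℚ-mono-≤ : ∀ {a b} → a ≤ b → ℕ→ℚ a ℚ.≤ ℕ→ℚ b
ℕ→ℚ-mono-≤ {a} {b} a≤b rewrite ℕ→ℚ≡ℕ→mkℚ a | ℕ→ℚ≡ℕ→mkℚ b =
  ℚ.*≤* (ℤP.*-monoʳ-≤-nonNeg (ℤ.+ 1) (ℤ.+≤+ a≤b))

ℕ→ℚ-cancel-≤ : ∀ {a b} → ℕ→ℚ a ℚ.≤ ℕ→ℚ b → a ≤ b
ℕ→ℚ-cancel-≤ {a} {b} a≤b rewrite ℕ→ℚ≡ℕ→mkℚ a | ℕ→ℚ≡ℕ→mkℚ b = ℤP.drop‿+≤+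
  (subst₂ ℤ._≤_ (ℤP.*-identityʳ (ℤ.+ a)) (ℤP.*-identityʳ (ℤ.+ b)) (ℚP.drop-*≤* a≤b))

ℕ→ℚ-nonNeg : ∀ k → 0ℚ ℚ.≤ ℕ→ℚ k
ℕ→ℚ-nonNeg k = ℕ→ℚ-mono-≤ {0} {k} z≤n

ℕ→ℚ-linear : ∀ a x b y → ℕ→ℚ (a ℕ.* x + b ℕ.* y) ≡ ℕ→ℚ a ℚ.* ℕ→ℚ x ℚ.+ ℕ→ℚ b ℚ.* ℕ→ℚ y
ℕ→ℚ-linear a x b y = trans (ℕ→ℚ-homo-+ (a ℕ.* x) (b ℕ.* y)) (cong₂ ℚ._+_ (ℕ→ℚ-homo-* a x) (ℕ→ℚ-homo-* b y))

*-nonNeg : ∀ {p q} → 0ℚ ℚ.≤ p → 0ℚ ℚ.≤ q → 0ℚ ℚ.≤ p ℚ.* q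
*-nonNeg {p} {q} 0≤p 0≤q =
  ℚP.nonNegative⁻¹ (p ℚ.* q) {{ℚP.nonNeg*nonNeg⇒nonNeg p {{ℚ.nonNegative 0≤p}} q {{ℚ.nonNegative 0≤q}}}}

ratio-*-denominator : ∀ c k → ratio c (suc k) ℚ.* ℕ→ℚ (suc k) ≡ ℕ→ℚ c
ratio-*-denominator c k rewrite ℕ→ℚ≡ℕ→mkℚ (suc k) | ℕ→ℚ≡ℕ→mkℚ c = ℚP.toℚᵘ-injective (begin
  ℚ.toℚᵘ (ratio c (suc k) ℚ.* ℕ→mkℚ (suc k))
    ≈⟨ ℚP.toℚᵘ-homo-* (ratio c (suc k)) (ℕ→mkℚ (suc k)) ⟩
  ℚ.toℚᵘ (ratio c (suc k)) ℚᵘ.* ℚ.toℚᵘ (ℕ→mkℚ (suc k))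
    ≈⟨ ℚᵘP.*-congʳ (ℚP.toℚᵘ-fromℚᵘ (mkℚᵘ (ℤ.+ c) k)) ⟩
  mkℚᵘ (ℤ.+ c) k ℚᵘ.* ℚ.toℚᵘ (ℕ→mkℚ (suc k))
    ≈⟨ ℚᵘ.*≡* (solve 2 (λ x y → (x :* y) :* con (ℤ.+ 1) := x :* (y :* con (ℤ.+ 1))) refl (ℤ.+ c) (ℤ.+ suc k)) ⟩
  ℚ.toℚᵘ (ℕ→mkℚ c)                                         ∎)
  where
  open ℚᵘP.≃-Reasoning
  open ℤ-Solver

≤ratio⇒*≤ : ∀ {h} c k → h ℚ.≤ ratio c (suc k) → h ℚ.* ℕ→ℚ (suc k) ℚ.≤ ℕ→ℚ c
≤ratio⇒*≤ c k h≤c/k = ℚP.≤-trans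
  (ℚP.*-monoʳ-≤-nonNeg (ℕ→ℚ (suc k)) {{ℚ.nonNegative (ℕ→ℚ-nonNeg (suc k))}} h≤c/k)
  (ℚP.≤-reflexive (ratio-*-denominator c k))

÷≤ratio : ∀ p q .{{_ : ℚ.Positive q}} c {m} → 1 ≤ m → p ℚ.* ℕ→ℚ m ℚ.≤ q ℚ.* ℕ→ℚ c →
  (p ℚ.÷ q) {{ℚP.pos⇒nonZero q}} ℚ.≤ ratio c m
÷≤ratio p q c {suc k} _ pm≤qc = ℚP.*-cancelʳ-≤-pos (q ℚ.* K) {{ℚP.pos*pos⇒pos q K {{ℚ.positive K>0}}}} (begin
  (p ℚ.÷ q) ℚ.* (q ℚ.* K)
    ≡⟨ solve 4 (λ p q q⁻¹ K → (p :* q⁻¹) :* (q :* K) := p :* (q⁻¹ :* q) :* K) refl p q q⁻¹ K ⟩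
  p ℚ.* (q⁻¹ ℚ.* q) ℚ.* K
    ≡⟨ cong (λ r → p ℚ.* r ℚ.* K) (ℚP.*-inverseˡ q) ⟩
  p ℚ.* 1ℚ ℚ.* K
    ≡⟨ cong (ℚ._* K) (ℚP.*-identityʳ p) ⟩
  p ℚ.* K
    ≤⟨ pm≤qc ⟩
  q ℚ.* ℕ→ℚ c
    ≡⟨ cong (q ℚ.*_) (ratio-*-denominator c k) ⟨
  q ℚ.* (ratio c (suc k) ℚ.* K)
    ≡⟨ solve 3 (λ q r K → q :* (r :* K) := r :* (q :* K)) refl q (ratio c (suc k)) K ⟩
  ratio c (suc k) ℚ.* (q ℚ.* K)       ∎)
  where
  open ℚP.≤-Reasoning
  open ℚ-Solver
  instance
    q≢0 : ℚ.NonZero q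
    q≢0 = ℚP.pos⇒nonZero q
  K q⁻¹ : ℚ
  K = ℕ→ℚ (suc k)
  q⁻¹ = ℚ.1/ q
  K>0 : 0ℚ ℚ.< K
  K>0 = ℚP.<-≤-trans (ℚP.positive⁻¹ 1ℚ) (ℕ→ℚ-mono-≤ {1} {suc k} (s≤s z≤n))

*-sum-mono-≤ : ∀ {m} (p q : ℚ) (f g : Fin m → ℕ) →
  (∀ i → p ℚ.* ℕ→ℚ (f i) ℚ.≤ q ℚ.* ℕ→ℚ (g i)) → p ℚ.* ℕ→ℚ (sum f) ℚ.≤ q ℚ.* ℕ→ℚ (sum g)
*-sum-mono-≤ {zero}  p q f g pf≤qg = ℚP.≤-reflexive (trans (ℚP.*-zeroʳ p) (sym (ℚP.*-zeroʳ q)))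
*-sum-mono-≤ {suc m} p q f g pf≤qg = begin
  p ℚ.* ℕ→ℚ (f₀ + sum fₛ)
    ≡⟨ cong (p ℚ.*_) (ℕ→ℚ-homo-+ f₀ (sum fₛ)) ⟩
  p ℚ.* (ℕ→ℚ f₀ ℚ.+ ℕ→ℚ (sum fₛ))
    ≡⟨ ℚP.*-distribˡ-+ p (ℕ→ℚ f₀) (ℕ→ℚ (sum fₛ)) ⟩
  p ℚ.* ℕ→ℚ f₀ ℚ.+ p ℚ.* ℕ→ℚ (sum fₛ)
    ≤⟨ ℚP.+-mono-≤ (pf≤qg Fin.zero) (*-sum-mono-≤ p q fₛ gₛ (λ i → pf≤qg (Fin.suc i))) ⟩
  q ℚ.* ℕ→ℚ g₀ ℚ.+ q ℚ.* ℕ→ℚ (sum gₛ)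
    ≡⟨ ℚP.*-distribˡ-+ q (ℕ→ℚ g₀) (ℕ→ℚ (sum gₛ)) ⟨
  q ℚ.* (ℕ→ℚ g₀ ℚ.+ ℕ→ℚ (sum gₛ))
    ≡⟨ cong (q ℚ.*_) (ℕ→ℚ-homo-+ g₀ (sum gₛ)) ⟨
  q ℚ.* ℕ→ℚ (g₀ + sum gₛ)                    ∎
  where
  open ℚP.≤-Reasoning
  f₀ g₀ : ℕ
  f₀ = f Fin.zero
  g₀ = g Fin.zero
  fₛ gₛ : Fin m → ℕ
  fₛ = λ i → f (Fin.suc i)
  gₛ = λ i → g (Fin.suc i)

*-when-mono-≤ : ∀ (p q : ℚ) {x y} b → p ℚ.* ℕ→ℚ x ℚ.≤ q ℚ.* ℕ→ℚ y →
  p ℚ.* ℕ→ℚ (x when b) ℚ.≤ q ℚ.* ℕ→ℚ (y when b)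
*-when-mono-≤ p q true  px≤qy = px≤qy
*-when-mono-≤ p q false _     = ℚP.≤-reflexive (trans (ℚP.*-zeroʳ p) (sym (ℚP.*-zeroʳ q)))

edgeExpansion≤degree : ∀ {m} (A : Adj m) {h d} → IsRegular A d → IsEdgeExpander A h → 2 ≤ m → h ℚ.≤ ℕ→ℚ d
edgeExpansion≤degree {suc (suc m)} A {h} {d} A-reg A-exp (s≤s (s≤s _)) = begin
  h
    ≤⟨ A-exp S (subst (0 ℕ.<_) (sym |S|≡1) (s≤s z≤n))
        (subst (λ c → 2 ℕ.* c ≤ suc (suc m)) (sym |S|≡1) (s≤s (s≤s z≤n))) ⟩
  ratio (cut A S) (count S)
    ≡⟨ cong (ratio (cut A S)) |S|≡1 ⟩
  ℕ→ℚ (cut A S)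
    ≤⟨ ℕ→ℚ-mono-≤ (cut≤vol A S) ⟩
  ℕ→ℚ (vol A S)
    ≡⟨ cong ℕ→ℚ (trans (vol-regular A A-reg S) (trans (cong (d ℕ.*_) |S|≡1) (ℕP.*-identityʳ d))) ⟩
  ℕ→ℚ d                          ∎
  where
  open ℚP.≤-Reasoning
  S : Subset (suc (suc m))
  S u = does (u Fin.≟ Fin.zero)
  |S|≡1 : count S ≡ 1
  |S|≡1 = count-singleton {suc (suc m)} Fin.zero

edgeExpander⇒*count≤cut : ∀ {m} (A : Adj m) {h} → IsEdgeExpander A h → 0ℚ ℚ.≤ h →
  ∀ S → 2 ℕ.* count S ≤ m → h ℚ.* ℕ→ℚ (count S) ℚ.≤ ℕ→ℚ (cut A S)
edgeExpander⇒*count≤cut A {h} A-exp 0≤h S small with count S in |S|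
... | zero  = ℚP.≤-trans (ℚP.≤-reflexive (ℚP.*-zeroʳ h)) (ℕ→ℚ-nonNeg (cut A S))
... | suc k = ≤ratio⇒*≤ (cut A S) k (subst (λ c → h ℚ.≤ ratio (cut A S) c) |S| expands)
  where
  expands : h ℚ.≤ ratio (cut A S) (count S)
  expands = A-exp S (subst (0 ℕ.<_) (sym |S|) (s≤s z≤n)) (subst (λ c → 2 ℕ.* c ≤ _) (sym |S|) small)

2[p+c]+v≤2c+3v : ∀ {p c v} → p ≤ v → 2 ℕ.* (p + c) + v ≤ 2 ℕ.* c + 3 ℕ.* v
2[p+c]+v≤2c+3v {p} {c} {v} p≤v = begin
  2 ℕ.* (p + c) + v
    ≡⟨ solve 3 (λ p c v → con 2 :* (p :+ c) :+ v := con 2 :* c :+ (con 2 :* p :+ v)) refl p c v ⟩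
  2 ℕ.* c + (2 ℕ.* p + v) ≤⟨ ℕP.+-monoʳ-≤ (2 ℕ.* c) (ℕP.+-monoˡ-≤ v (ℕP.*-monoʳ-≤ 2 p≤v)) ⟩
  2 ℕ.* c + (2 ℕ.* v + v) ≡⟨ solve 2 (λ c v → con 2 :* c :+ (con 2 :* v :+ v) := con 2 :* c :+ con 3 :* v) refl c v ⟩
  2 ℕ.* c + 3 ℕ.* v       ∎
  where
  open ℕP.≤-Reasoning
  open ℕ-Solver

combine-bounds : ∀ (ε ϕ α : ℚ) (v c y x t : ℕ) → 0ℚ ℚ.≤ ϕ → ϕ ℚ.≤ α →
  ε ℚ.* ℕ→ℚ v ℚ.≤ ℕ→ℚ (2 ℕ.* c + 3 ℕ.* y) → ϕ ℚ.* ℕ→ℚ y ℚ.≤ α ℚ.* ℕ→ℚ x → c + x ≤ t →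
  ϕ ℚ.* ε ℚ.* ℕ→ℚ v ℚ.≤ 5ℚ ℚ.* α ℚ.* ℕ→ℚ t
combine-bounds ε ϕ α v c y x t 0≤ϕ ϕ≤α εv≤2c+3y ϕy≤αx c+x≤t = begin
  ϕ ℚ.* ε ℚ.* ℕ→ℚ v
    ≡⟨ ℚP.*-assoc ϕ ε (ℕ→ℚ v) ⟩
  ϕ ℚ.* (ε ℚ.* ℕ→ℚ v)
    ≤⟨ ℚP.*-monoˡ-≤-nonNeg ϕ {{ℚ.nonNegative 0≤ϕ}} εv≤2c+3y ⟩
  ϕ ℚ.* ℕ→ℚ (2 ℕ.* c + 3 ℕ.* y)
    ≡⟨ cong (ϕ ℚ.*_) (ℕ→ℚ-linear 2 c 3 y) ⟩
  ϕ ℚ.* (⌜2⌝ ℚ.* ⌜c⌝ ℚ.+ ⌜3⌝ ℚ.* ⌜y⌝)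
    ≡⟨ solve 5 (λ ϕ t h c y → ϕ :* (t :* c :+ h :* y) := t :* (ϕ :* c) :+ h :* (ϕ :* y)) refl ϕ ⌜2⌝ ⌜3⌝ ⌜c⌝ ⌜y⌝ ⟩
  ⌜2⌝ ℚ.* (ϕ ℚ.* ⌜c⌝) ℚ.+ ⌜3⌝ ℚ.* (ϕ ℚ.* ⌜y⌝)
    ≤⟨ ℚP.+-mono-≤ (ℚP.*-monoˡ-≤-nonNeg ⌜2⌝ {{ℚ.nonNegative (ℕ→ℚ-nonNeg 2)}}
                      (ℚP.*-monoʳ-≤-nonNeg ⌜c⌝ {{ℚ.nonNegative (ℕ→ℚ-nonNeg c)}} ϕ≤α))
        (ℚP.*-monoˡ-≤-nonNeg ⌜3⌝ {{ℚ.nonNegative (ℕ→ℚ-nonNeg 3)}} ϕy≤αx) ⟩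
  ⌜2⌝ ℚ.* (α ℚ.* ⌜c⌝) ℚ.+ ⌜3⌝ ℚ.* (α ℚ.* ⌜x⌝)
    ≡⟨ solve 5 (λ t h c x α → t :* (α :* c) :+ h :* (α :* x) := α :* (t :* c :+ h :* x)) refl ⌜2⌝ ⌜3⌝ ⌜c⌝ ⌜x⌝ α ⟩
  α ℚ.* (⌜2⌝ ℚ.* ⌜c⌝ ℚ.+ ⌜3⌝ ℚ.* ⌜x⌝)
    ≡⟨ cong (α ℚ.*_) (ℕ→ℚ-linear 2 c 3 x) ⟨
  α ℚ.* ℕ→ℚ (2 ℕ.* c + 3 ℕ.* x)
    ≤⟨ ℚP.*-monoˡ-≤-nonNeg α {{ℚ.nonNegative (ℚP.≤-trans 0≤ϕ ϕ≤α)}} (ℕ→ℚ-mono-≤ 2c+3x≤5t) ⟩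
  α ℚ.* ℕ→ℚ (5 ℕ.* t)
    ≡⟨ cong (α ℚ.*_) (ℕ→ℚ-homo-* 5 t) ⟩
  α ℚ.* (5ℚ ℚ.* ⌜t⌝)
    ≡⟨ solve 3 (λ α f t → α :* (f :* t) := f :* α :* t) refl α 5ℚ ⌜t⌝ ⟩
  5ℚ ℚ.* α ℚ.* ⌜t⌝                     ∎
  where
  open ℚP.≤-Reasoning
  open ℚ-Solver
  ⌜2⌝ ⌜3⌝ ⌜c⌝ ⌜y⌝ ⌜x⌝ ⌜t⌝ : ℚ
  ⌜2⌝ = ℕ→ℚ 2
  ⌜3⌝ = ℕ→ℚ 3
  ⌜c⌝ = ℕ→ℚ c
  ⌜y⌝ = ℕ→ℚ y
  ⌜x⌝ = ℕ→ℚ x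
  ⌜t⌝ = ℕ→ℚ t
  2c+3x≤5t : 2 ℕ.* c + 3 ℕ.* x ≤ 5 ℕ.* t
  2c+3x≤5t = ℕP.≤-trans
    (ℕP.+-mono-≤ (ℕP.*-monoˡ-≤ c {2} {5} (s≤s (s≤s z≤n))) (ℕP.*-monoˡ-≤ x {3} {5} (s≤s (s≤s (s≤s z≤n)))))
    (ℕP.≤-trans (ℕP.≤-reflexive (sym (ℕP.*-distribˡ-+ 5 c x))) (ℕP.*-monoʳ-≤ 5 c+x≤t))

module Split {n k : ℕ} (A : Adj (n + k)) where

  induced-↑ʳ : Adj k
  induced-↑ʳ w w′ = A (n ↑ʳ w) (n ↑ʳ w′)

  restrict-↑ʳ : Subset (n + k) → Subset k
  restrict-↑ʳ S w = S (n ↑ʳ w)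

  edges-↑ˡ-↑ʳ : Subset (n + k) → Subset k → ℕ
  edges-↑ˡ-↑ʳ S Q = sum (λ a → count (λ w → A (a ↑ˡ k) (n ↑ʳ w) ∧ Q w) when S (a ↑ˡ k))

  vol-↑ : ∀ S → vol A S ≡
    sum (λ a → deg A (a ↑ˡ k) when S (a ↑ˡ k)) + sum (λ w → deg A (n ↑ʳ w) when S (n ↑ʳ w))
  vol-↑ S = trans (vol≡sum A S) (sum-↑ n (λ v → deg A v when S v))

  edges-↑ˡ-↑ʳ-split : ∀ S →
    sum (λ a → count (λ w → A (a ↑ˡ k) (n ↑ʳ w)) when S (a ↑ˡ k)) ≡
    edges-↑ˡ-↑ʳ S (restrict-↑ʳ S) + edges-↑ˡ-↑ʳ S (compl (restrict-↑ʳ S))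
  edges-↑ˡ-↑ʳ-split S = trans (sum-cong-≗ split) (∑-distrib-+ (inside S) (inside (compl S)))
    where
    inside : Subset (n + k) → Fin n → ℕ
    inside Q a = count (λ w → A (a ↑ˡ k) (n ↑ʳ w) ∧ Q (n ↑ʳ w)) when S (a ↑ˡ k)
    split : ∀ a → count (λ w → A (a ↑ˡ k) (n ↑ʳ w)) when S (a ↑ˡ k) ≡ inside S a + inside (compl S) a
    split a = trans (cong (_when S (a ↑ˡ k)) (count-∧-split (λ w → A (a ↑ˡ k) (n ↑ʳ w)) (restrict-↑ʳ S)))
      (when-distrib-+ (S (a ↑ˡ k)) _ _)

  edges-↑ˡ-↑ʳ-inside-≤ : IsSymmetric A → ∀ S →
    edges-↑ˡ-↑ʳ S (restrict-↑ʳ S) ≤ sum (λ w → deg A (n ↑ʳ w) when S (n ↑ʳ w))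
  edges-↑ˡ-↑ʳ-inside-≤ A-sym S = begin
    edges-↑ˡ-↑ʳ S (restrict-↑ʳ S)
      ≡⟨ sum-cong-≗ (λ a → sym (count-const-∧ (S (a ↑ˡ k)) (λ w → A (a ↑ˡ k) (n ↑ʳ w) ∧ S (n ↑ʳ w)))) ⟩
    sum (λ a → count (λ w → S (a ↑ˡ k) ∧ (A (a ↑ˡ k) (n ↑ʳ w) ∧ S (n ↑ʳ w))))
      ≡⟨ sum-count-comm (λ a w → S (a ↑ˡ k) ∧ (A (a ↑ˡ k) (n ↑ʳ w) ∧ S (n ↑ʳ w))) ⟩
    sum (λ w → count (λ a → S (a ↑ˡ k) ∧ (A (a ↑ˡ k) (n ↑ʳ w) ∧ S (n ↑ʳ w))))
      ≡⟨ sum-cong-≗ (λ w → count-cong (λ a → flip (a ↑ˡ k) (n ↑ʳ w))) ⟩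
    sum (λ w → count (λ a → S (n ↑ʳ w) ∧ (A (n ↑ʳ w) (a ↑ˡ k) ∧ S (a ↑ˡ k))))
      ≡⟨ sum-cong-≗ (λ w → count-const-∧ (S (n ↑ʳ w)) (λ a → A (n ↑ʳ w) (a ↑ˡ k) ∧ S (a ↑ˡ k))) ⟩
    sum (λ w → count (λ a → A (n ↑ʳ w) (a ↑ˡ k) ∧ S (a ↑ˡ k)) when S (n ↑ʳ w))
      ≤⟨ sum-mono (λ w → when-mono (S (n ↑ʳ w)) (ℕP.≤-trans
          (count-∧-≤ (λ a → A (n ↑ʳ w) (a ↑ˡ k)) (λ a → S (a ↑ˡ k)))
          (count-↑ˡ-≤ n (A (n ↑ʳ w))))) ⟩
    sum (λ w → deg A (n ↑ʳ w) when S (n ↑ʳ w))          ∎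
    where
    open ℕP.≤-Reasoning
    flip : ∀ u v → S u ∧ (A u v ∧ S v) ≡ S v ∧ (A v u ∧ S u)
    flip u v rewrite A-sym u v with S u | S v
    ... | false | false = refl
    ... | false | true  = sym (∧-zeroʳ (A v u))
    ... | true  | false = ∧-zeroʳ (A v u)
    ... | true  | true  = refl

  edges-↑ˡ-↑ʳ+cut-induced≤cut : ∀ S →
    edges-↑ˡ-↑ʳ S (compl (restrict-↑ʳ S)) + cut induced-↑ʳ (restrict-↑ʳ S) ≤ cut A S
  edges-↑ˡ-↑ʳ+cut-induced≤cut S = begin
    edges-↑ˡ-↑ʳ S (compl (restrict-↑ʳ S)) + cut induced-↑ʳ (restrict-↑ʳ S)
      ≡⟨ cong (edges-↑ˡ-↑ʳ S (compl (restrict-↑ʳ S)) +_) (cut≡sum induced-↑ʳ (restrict-↑ʳ S)) ⟩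
    sum (λ a → leaving (a ↑ˡ k) (λ w → A (a ↑ˡ k) (n ↑ʳ w) ∧ not (S (n ↑ʳ w))))
      + sum (λ w → leaving (n ↑ʳ w) (λ w′ → A (n ↑ʳ w) (n ↑ʳ w′) ∧ not (S (n ↑ʳ w′))))
      ≤⟨ ℕP.+-mono-≤ (sum-mono (λ a → when-mono (S (a ↑ˡ k)) (count-↑ʳ-≤ n (crossing (a ↑ˡ k)))))
          (sum-mono (λ w → when-mono (S (n ↑ʳ w)) (count-↑ʳ-≤ n (crossing (n ↑ʳ w))))) ⟩
    sum (λ a → leaving (a ↑ˡ k) (crossing (a ↑ˡ k))) + sum (λ w → leaving (n ↑ʳ w) (crossing (n ↑ʳ w)))
      ≡⟨ sum-↑ n (λ u → leaving u (crossing u)) ⟨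
    sum (λ u → leaving u (crossing u))
      ≡⟨ cut≡sum A S ⟨
    cut A S                             ∎
    where
    open ℕP.≤-Reasoning
    crossing : Fin (n + k) → Subset (n + k)
    crossing u v = A u v ∧ not (S v)
    leaving : ∀ {m} → Fin (n + k) → Subset m → ℕ
    leaving u f = count f when S u

module Expanded (n N : ℕ) (G : SimpleGraph n) (B : Fin n → Fin N → Bool) (X : Fin N → Fin N → Bool) where

  E : Adj (n + (N + N))
  E = expAdj n N (adj G) B X

  open Split {n} {N + N} E public

  vV : Fin n → Fin (n + (N + N))
  vV a = a ↑ˡ (N + N)

  vR : Fin N → Fin (n + (N + N))
  vR j = n ↑ʳ (N ↑ʳ j)

  side-vV : ∀ a → side n N (vV a) ≡ inV a
  side-vV a rewrite splitAt-↑ˡ n a (N + N) = refl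

  side-vL : ∀ i → side n N (vL n N i) ≡ inL i
  side-vL i rewrite splitAt-↑ʳ n (N + N) (i ↑ˡ N) | splitAt-↑ˡ N i N = refl

  side-vR : ∀ j → side n N (vR j) ≡ inR j
  side-vR j rewrite splitAt-↑ʳ n (N + N) (N ↑ʳ j) | splitAt-↑ʳ N N j = refl

  E-sym : IsSymmetric E
  E-sym u v = sideSym (side n N u) (side n N v)
    where
    sideSym : ∀ s t → expAdjSide (adj G) B X s t ≡ expAdjSide (adj G) B X t s
    sideSym (inV a) (inV b) = SimpleGraph.sym G a b
    sideSym (inV a) (inL i) = refl
    sideSym (inV a) (inR j) = refl
    sideSym (inL i) (inV a) = refl
    sideSym (inL i) (inL j) = refl
    sideSym (inL i) (inR j) = refl
    sideSym (inR i) (inV a) = refl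
    sideSym (inR i) (inL j) = refl
    sideSym (inR i) (inR j) = refl

  induced-↑ʳ≗bipAdj : ∀ w w′ → induced-↑ʳ w w′ ≡ bipAdj N X w w′
  induced-↑ʳ≗bipAdj w w′ rewrite splitAt-↑ʳ n (N + N) w | splitAt-↑ʳ n (N + N) w′
    with splitAt N w | splitAt N w′
  ... | inj₁ i | inj₁ i′ = refl
  ... | inj₁ i | inj₂ j  = refl
  ... | inj₂ j | inj₁ i  = refl
  ... | inj₂ j | inj₂ j′ = refl

  count-vV-↑ʳ : ∀ a → count (λ w → E (vV a) (n ↑ʳ w)) ≡ count (B a)
  count-vV-↑ʳ a = begin
    count (λ w → E (vV a) (n ↑ʳ w))
      ≡⟨ count-↑ N (λ w → E (vV a) (n ↑ʳ w)) ⟩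
    count (λ i → E (vV a) (vL n N i)) + count (λ j → E (vV a) (vR j))
      ≡⟨ cong₂ _+_ (count-cong toL) (count-cong toR) ⟩
    count (B a) + count {N} (λ _ → false)
      ≡⟨ cong (count (B a) +_) (count-false N) ⟩
    count (B a) + 0
      ≡⟨ ℕP.+-identityʳ (count (B a)) ⟩
    count (B a)                                                         ∎
    where
    open ≡-Reasoning
    toL : ∀ i → E (vV a) (vL n N i) ≡ B a i
    toL i = cong₂ (expAdjSide (adj G) B X) (side-vV a) (side-vL i)
    toR : ∀ j → E (vV a) (vR j) ≡ false
    toR j = cong₂ (expAdjSide (adj G) B X) (side-vV a) (side-vR j)

  deg-vV : ∀ a → deg E (vV a) ≡ deg (adj G) a + count (B a)
  deg-vV a = trans (count-↑ n (E (vV a)))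
    (cong₂ _+_ (count-cong (λ b → cong₂ (expAdjSide (adj G) B X) (side-vV a) (side-vV b))) (count-vV-↑ʳ a))

  deg-vR : ∀ j → deg E (vR j) ≡ deg (bipAdj N X) (N ↑ʳ j)
  deg-vR j = begin
    deg E (vR j)
      ≡⟨ count-↑ n (E (vR j)) ⟩
    count (λ a → E (vR j) (vV a)) + count (λ w → E (vR j) (n ↑ʳ w))
      ≡⟨ cong₂ _+_ (count-cong toV) (count-cong (induced-↑ʳ≗bipAdj (N ↑ʳ j))) ⟩
    count {n} (λ _ → false) + deg (bipAdj N X) (N ↑ʳ j)
      ≡⟨ cong (_+ deg (bipAdj N X) (N ↑ʳ j)) (count-false n) ⟩
    deg (bipAdj N X) (N ↑ʳ j)                                          ∎
    where
    open ≡-Reasoning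
    toV : ∀ a → E (vR j) (vV a) ≡ false
    toV a = cong₂ (expAdjSide (adj G) B X) (side-vR j) (side-vV a)

L-nonempty : ∀ n N (B : Fin n → Fin N → Bool) → (∀ a → 1 ≤ count (B a)) → 0 ℕ.< n + (N + N) → 1 ≤ N
L-nonempty n       (suc N) B B≥1 _ = s≤s z≤n
L-nonempty (suc n) zero    B B≥1 _ with B≥1 Fin.zero
... | ()

module Estimate {n N : ℕ} (G : SimpleGraph n) (B : Fin n → Fin N → Bool) (X : Fin N → Fin N → Bool)
  (ε α ϕ : ℚ) (dX : ℕ) (0≤ε : 0ℚ ℚ.≤ ε) (ε≤1 : ε ℚ.≤ 1ℚ) (1≤α : 1ℚ ℚ.≤ α) (1≤dX : 1 ≤ dX)
  (0≤ϕ : 0ℚ ℚ.≤ ϕ)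
  (B-large : ∀ a → ε ℚ.* ℕ→ℚ (deg (adj G) a) ℚ.+ 1ℚ ℚ.≤ ℕ→ℚ (count (B a)))
  (X-regular : IsRegular (bipAdj N X) dX)
  (X-expander : IsEdgeExpander (bipAdj N X) (ϕ ℚ.* ℕ→ℚ dX))
  (L-deg≥ : ∀ i → dX ≤ deg (expAdj n N (adj G) B X) (vL n N i))
  (L-deg≤ : ∀ i → ℕ→ℚ (deg (expAdj n N (adj G) B X) (vL n N i)) ℚ.≤ α ℚ.* ℕ→ℚ dX) where

  open Expanded n N G B X public

  εdeg≤count-B : ∀ a → ε ℚ.* ℕ→ℚ (deg (adj G) a) ℚ.≤ ℕ→ℚ (count (B a))
  εdeg≤count-B a = begin
    ε ℚ.* ℕ→ℚ (deg (adj G) a)            ≡⟨ ℚP.+-identityʳ _ ⟨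
    ε ℚ.* ℕ→ℚ (deg (adj G) a) ℚ.+ 0ℚ     ≤⟨ ℚP.+-monoʳ-≤ (ε ℚ.* ℕ→ℚ (deg (adj G) a)) (ℚP.nonNegative⁻¹ 1ℚ) ⟩
    ε ℚ.* ℕ→ℚ (deg (adj G) a) ℚ.+ 1ℚ     ≤⟨ B-large a ⟩
    ℕ→ℚ (count (B a))                    ∎
    where open ℚP.≤-Reasoning

  ε*-≤ : ∀ k → ε ℚ.* ℕ→ℚ k ℚ.≤ ℕ→ℚ k
  ε*-≤ k = ℚP.≤-trans (ℚP.*-monoʳ-≤-nonNeg (ℕ→ℚ k) {{ℚ.nonNegative (ℕ→ℚ-nonNeg k)}} ε≤1)
    (ℚP.≤-reflexive (ℚP.*-identityˡ (ℕ→ℚ k)))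

  εdeg-vV≤2count-B : ∀ a → ε ℚ.* ℕ→ℚ (deg E (vV a)) ℚ.≤ ℕ→ℚ 2 ℚ.* ℕ→ℚ (count (B a))
  εdeg-vV≤2count-B a = begin
    ε ℚ.* ℕ→ℚ (deg E (vV a))
      ≡⟨ cong (λ d → ε ℚ.* ℕ→ℚ d) (deg-vV a) ⟩
    ε ℚ.* ℕ→ℚ (dG + b)
      ≡⟨ trans (cong (ε ℚ.*_) (ℕ→ℚ-homo-+ dG b)) (ℚP.*-distribˡ-+ ε (ℕ→ℚ dG) (ℕ→ℚ b)) ⟩
    ε ℚ.* ℕ→ℚ dG ℚ.+ ε ℚ.* ℕ→ℚ b
      ≤⟨ ℚP.+-mono-≤ (εdeg≤count-B a) (ε*-≤ b) ⟩
    ℕ→ℚ b ℚ.+ ℕ→ℚ b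
      ≡⟨ ℕ→ℚ-homo-+ b b ⟨
    ℕ→ℚ (b + b)
      ≡⟨ cong (λ c → ℕ→ℚ (b + c)) (ℕP.+-identityʳ b) ⟨
    ℕ→ℚ (2 ℕ.* b)
      ≡⟨ ℕ→ℚ-homo-* 2 b ⟩
    ℕ→ℚ 2 ℚ.* ℕ→ℚ b                     ∎
    where
    open ℚP.≤-Reasoning
    dG b : ℕ
    dG = deg (adj G) a
    b = count (B a)

  deg-vR≡dX : ∀ j → deg E (vR j) ≡ dX
  deg-vR≡dX j = trans (deg-vR j) (X-regular (N ↑ʳ j))

  deg-↑ʳ≤αdX : ∀ w → ℕ→ℚ (deg E (n ↑ʳ w)) ℚ.≤ α ℚ.* ℕ→ℚ dX
  deg-↑ʳ≤αdX = splitAt-elim (λ w → ℕ→ℚ (deg E (n ↑ʳ w)) ℚ.≤ α ℚ.* ℕ→ℚ dX) L-deg≤ R-deg≤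
    where
    R-deg≤ : ∀ j → ℕ→ℚ (deg E (vR j)) ℚ.≤ α ℚ.* ℕ→ℚ dX
    R-deg≤ j = ℚP.≤-trans (ℚP.≤-reflexive (trans (cong ℕ→ℚ (deg-vR≡dX j)) (sym (ℚP.*-identityˡ (ℕ→ℚ dX)))))
      (ℚP.*-monoʳ-≤-nonNeg (ℕ→ℚ dX) {{ℚ.nonNegative (ℕ→ℚ-nonNeg dX)}} 1≤α)

  module _ (T : Subset (n + (N + N))) where

    Tʳ : Subset (N + N)
    Tʳ = restrict-↑ʳ T

    volˡ volʳ leaving : ℕ
    volˡ = sum (λ a → deg E (vV a) when T (vV a))
    volʳ = sum (λ w → deg E (n ↑ʳ w) when Tʳ w)
    leaving = edges-↑ˡ-↑ʳ T (compl Tʳ)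

    εvol≤ : ε ℚ.* ℕ→ℚ (vol E T) ℚ.≤ ℕ→ℚ (2 ℕ.* leaving + 3 ℕ.* volʳ)
    εvol≤ = begin
      ε ℚ.* ℕ→ℚ (vol E T)
        ≡⟨ cong (λ v → ε ℚ.* ℕ→ℚ v) (vol-↑ T) ⟩
      ε ℚ.* ℕ→ℚ (volˡ + volʳ)
        ≡⟨ trans (cong (ε ℚ.*_) (ℕ→ℚ-homo-+ volˡ volʳ)) (ℚP.*-distribˡ-+ ε _ _) ⟩
      ε ℚ.* ℕ→ℚ volˡ ℚ.+ ε ℚ.* ℕ→ℚ volʳ
        ≤⟨ ℚP.+-mono-≤ εvolˡ≤ (ε*-≤ volʳ) ⟩
      ℕ→ℚ 2 ℚ.* ℕ→ℚ edgesˡ ℚ.+ ℕ→ℚ volʳ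
        ≡⟨ cong (ℚ._+ ℕ→ℚ volʳ) (ℕ→ℚ-homo-* 2 edgesˡ) ⟨
      ℕ→ℚ (2 ℕ.* edgesˡ) ℚ.+ ℕ→ℚ volʳ
        ≡⟨ ℕ→ℚ-homo-+ (2 ℕ.* edgesˡ) volʳ ⟨
      ℕ→ℚ (2 ℕ.* edgesˡ + volʳ)
        ≤⟨ ℕ→ℚ-mono-≤ (ℕP.≤-trans (ℕP.+-monoˡ-≤ volʳ (ℕP.*-monoʳ-≤ 2 edgesˡ≤))
            (2[p+c]+v≤2c+3v (edges-↑ˡ-↑ʳ-inside-≤ E-sym T))) ⟩
      ℕ→ℚ (2 ℕ.* leaving + 3 ℕ.* volʳ)              ∎
      where
      open ℚP.≤-Reasoning
      edgesˡ : ℕ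
      edgesˡ = sum (λ a → count (B a) when T (vV a))
      εvolˡ≤ : ε ℚ.* ℕ→ℚ volˡ ℚ.≤ ℕ→ℚ 2 ℚ.* ℕ→ℚ edgesˡ
      εvolˡ≤ = *-sum-mono-≤ ε (ℕ→ℚ 2) _ _ (λ a → *-when-mono-≤ ε (ℕ→ℚ 2) (T (vV a)) (εdeg-vV≤2count-B a))
      edgesˡ≤ : edgesˡ ≤ edges-↑ˡ-↑ʳ T Tʳ + leaving
      edgesˡ≤ = ℕP.≤-reflexive (trans (sum-cong-≗ (λ a → cong (_when T (vV a)) (sym (count-vV-↑ʳ a))))
        (edges-↑ˡ-↑ʳ-split T))

    ϕvolʳ≤ : 2 ℕ.* count Tʳ ≤ N + N → ϕ ℚ.* ℕ→ℚ volʳ ℚ.≤ α ℚ.* ℕ→ℚ (cut induced-↑ʳ Tʳ)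
    ϕvolʳ≤ small = begin
      ϕ ℚ.* ℕ→ℚ volʳ
        ≤⟨ ℚP.*-monoˡ-≤-nonNeg ϕ {{ℚ.nonNegative 0≤ϕ}} volʳ≤ ⟩
      ϕ ℚ.* (α ℚ.* ℕ→ℚ dX ℚ.* ℕ→ℚ (count Tʳ))
        ≡⟨ solve 4 (λ ϕ α d t → ϕ :* (α :* d :* t) := α :* (ϕ :* d :* t)) refl ϕ α (ℕ→ℚ dX) (ℕ→ℚ (count Tʳ)) ⟩
      α ℚ.* (ϕ ℚ.* ℕ→ℚ dX ℚ.* ℕ→ℚ (count Tʳ))
        ≤⟨ ℚP.*-monoˡ-≤-nonNeg α {{ℚ.nonNegative 0≤α}} expansion ⟩
      α ℚ.* ℕ→ℚ (cut (bipAdj N X) Tʳ)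
        ≡⟨ cong (λ c → α ℚ.* ℕ→ℚ c) (cut-cong induced-↑ʳ≗bipAdj Tʳ) ⟨
      α ℚ.* ℕ→ℚ (cut induced-↑ʳ Tʳ)             ∎
      where
      open ℚP.≤-Reasoning
      open ℚ-Solver
      0≤α : 0ℚ ℚ.≤ α
      0≤α = ℚP.≤-trans (ℚP.nonNegative⁻¹ 1ℚ) 1≤α
      volʳ≤ : ℕ→ℚ volʳ ℚ.≤ α ℚ.* ℕ→ℚ dX ℚ.* ℕ→ℚ (count Tʳ)
      volʳ≤ = begin
        ℕ→ℚ volʳ                                   ≡⟨ ℚP.*-identityˡ (ℕ→ℚ volʳ) ⟨
        1ℚ ℚ.* ℕ→ℚ volʳ                            ≤⟨ *-sum-mono-≤ 1ℚ αdX _ (λ w → 1 when Tʳ w)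
                                                        (λ w → *-when-mono-≤ 1ℚ αdX (Tʳ w) (deg≤ w)) ⟩
        αdX ℚ.* ℕ→ℚ (sum (λ w → 1 when Tʳ w))      ≡⟨ cong (λ c → αdX ℚ.* ℕ→ℚ c) (count≡sum Tʳ) ⟨
        αdX ℚ.* ℕ→ℚ (count Tʳ)                     ∎
        where
        αdX : ℚ
        αdX = α ℚ.* ℕ→ℚ dX
        deg≤ : ∀ w → 1ℚ ℚ.* ℕ→ℚ (deg E (n ↑ʳ w)) ℚ.≤ αdX ℚ.* ℕ→ℚ 1
        deg≤ w = begin
          1ℚ ℚ.* ℕ→ℚ (deg E (n ↑ʳ w))   ≡⟨ ℚP.*-identityˡ _ ⟩
          ℕ→ℚ (deg E (n ↑ʳ w))          ≤⟨ deg-↑ʳ≤αdX w ⟩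
          αdX                           ≡⟨ ℚP.*-identityʳ αdX ⟨
          αdX ℚ.* ℕ→ℚ 1                 ∎
      expansion : ϕ ℚ.* ℕ→ℚ dX ℚ.* ℕ→ℚ (count Tʳ) ℚ.≤ ℕ→ℚ (cut (bipAdj N X) Tʳ)
      expansion = edgeExpander⇒*count≤cut (bipAdj N X) X-expander
        (*-nonNeg 0≤ϕ (ℕ→ℚ-nonNeg dX)) Tʳ small

    one-sided : ϕ ℚ.≤ 1ℚ → 2 ℕ.* count Tʳ ≤ N + N →
      ϕ ℚ.* ε ℚ.* ℕ→ℚ (vol E T) ℚ.≤ 5ℚ ℚ.* α ℚ.* ℕ→ℚ (cut E T)
    one-sided ϕ≤1 small = combine-bounds ε ϕ α (vol E T) leaving volʳ (cut induced-↑ʳ Tʳ) (cut E T)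
      0≤ϕ (ℚP.≤-trans ϕ≤1 1≤α) εvol≤ (ϕvolʳ≤ small) (edges-↑ˡ-↑ʳ+cut-induced≤cut T)

  ϕε-mono : ∀ {a b} → a ≤ b → ϕ ℚ.* ε ℚ.* ℕ→ℚ a ℚ.≤ ϕ ℚ.* ε ℚ.* ℕ→ℚ b
  ϕε-mono a≤b = ℚP.*-monoˡ-≤-nonNeg (ϕ ℚ.* ε) {{ℚ.nonNegative (*-nonNeg 0≤ϕ 0≤ε)}} (ℕ→ℚ-mono-≤ a≤b)

  ϕε-min-vol≤ : ϕ ℚ.≤ 1ℚ → ∀ T →
    ϕ ℚ.* ε ℚ.* ℕ→ℚ (vol E T ℕ.⊓ vol E (compl T)) ℚ.≤ 5ℚ ℚ.* α ℚ.* ℕ→ℚ (cut E T)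
  ϕε-min-vol≤ ϕ≤1 T with 2 ℕ.* count (Tʳ T) ℕP.≤? N + N
  ... | yes small = ℚP.≤-trans (ϕε-mono (ℕP.m⊓n≤m (vol E T) (vol E (compl T)))) (one-sided T ϕ≤1 small)
  ... | no  large = ℚP.≤-trans (ϕε-mono (ℕP.m⊓n≤n (vol E T) (vol E (compl T))))
    (subst (λ c → ϕ ℚ.* ε ℚ.* ℕ→ℚ (vol E (compl T)) ℚ.≤ 5ℚ ℚ.* α ℚ.* ℕ→ℚ c) (cut-compl E E-sym T)
      (one-sided (compl T) ϕ≤1 (complement-small {count (Tʳ T)} (count-compl (Tʳ T)) (ℕP.≰⇒> large))))

  count-B≥1 : ∀ a → 1 ≤ count (B a)
  count-B≥1 a = ℕ→ℚ-cancel-≤ (begin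
    1ℚ                                   ≡⟨ ℚP.+-identityˡ 1ℚ ⟨
    0ℚ ℚ.+ 1ℚ                            ≤⟨ ℚP.+-monoˡ-≤ 1ℚ (*-nonNeg 0≤ε (ℕ→ℚ-nonNeg (deg (adj G) a))) ⟩
    ε ℚ.* ℕ→ℚ (deg (adj G) a) ℚ.+ 1ℚ     ≤⟨ B-large a ⟩
    ℕ→ℚ (count (B a))                    ∎)
    where open ℚP.≤-Reasoning

  deg≥1 : ∀ u → 1 ≤ deg E u
  deg≥1 = splitAt-elim (λ u → 1 ≤ deg E u) vV≥1 (splitAt-elim (λ w → 1 ≤ deg E (n ↑ʳ w)) vL≥1 vR≥1)
    where
    vV≥1 : ∀ a → 1 ≤ deg E (vV a)
    vV≥1 a = ℕP.≤-trans (count-B≥1 a) (subst (count (B a) ≤_) (sym (deg-vV a)) (ℕP.m≤n+m _ _))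
    vL≥1 : ∀ i → 1 ≤ deg E (vL n N i)
    vL≥1 i = ℕP.≤-trans 1≤dX (L-deg≥ i)
    vR≥1 : ∀ j → 1 ≤ deg E (vR j)
    vR≥1 j = subst (1 ≤_) (sym (deg-vR≡dX j)) 1≤dX

  ϕ≤1 : 1 ≤ N → ϕ ℚ.≤ 1ℚ
  ϕ≤1 1≤N = ℚP.*-cancelʳ-≤-pos (ℕ→ℚ dX)
    {{ℚ.positive (ℚP.<-≤-trans (ℚP.positive⁻¹ 1ℚ) (ℕ→ℚ-mono-≤ 1≤dX))}}
    (ℚP.≤-trans (edgeExpansion≤degree (bipAdj N X) X-regular X-expander (ℕP.+-mono-≤ 1≤N 1≤N))
      (ℚP.≤-reflexive (sym (ℚP.*-identityˡ (ℕ→ℚ dX)))))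

lemma2 : (ε α ϕ : ℚ) (dX : ℕ) → 0ℚ ℚ.< ε → ε ℚ.≤ 1ℚ → (1≤α : 1ℚ ℚ.≤ α) → ℕ._≤_ 3 dX → 0ℚ ℚ.< ϕ →
  (n N : ℕ) (G : SimpleGraph n) (B : Fin n → Fin N → Bool) (X : Fin N → Fin N → Bool) →
  (∀ (v : Fin n) → ε ℚ.* ℕ→ℚ (deg (adj G) v) ℚ.+ 1ℚ ℚ.≤ ℕ→ℚ (count (B v))) →
  IsRegular (bipAdj N X) dX →
  IsEdgeExpander (bipAdj N X) (ϕ ℚ.* ℕ→ℚ dX) →
  (∀ (i : Fin N) → ℕ._≤_ dX (deg (expAdj n N (adj G) B X) (vL n N i))) →
  (∀ (i : Fin N) → ℕ→ℚ (deg (expAdj n N (adj G) B X) (vL n N i)) ℚ.≤ α ℚ.* ℕ→ℚ dX) →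
  IsExpander (expAdj n N (adj G) B X) (bound ϕ ε α 1≤α)
lemma2 ε α ϕ dX 0<ε ε≤1 1≤α 3≤dX 0<ϕ n N G B X B-large X-regular X-expander L-deg≥ L-deg≤ T |T|>0 |T|<m =
  ÷≤ratio (ϕ ℚ.* ε) (5ℚ ℚ.* α) (cut E T) (ℕP.⊓-glb (vol≥1 T |T|>0) (vol≥1 (compl T) (compl-nonempty T |T|<m)))
    (ϕε-min-vol≤ (ϕ≤1 (L-nonempty n N B count-B≥1 (ℕP.<-trans |T|>0 |T|<m))) T)
  where
  open Estimate G B X ε α ϕ dX (ℚP.<⇒≤ 0<ε) ε≤1 1≤α (ℕP.≤-trans (s≤s z≤n) 3≤dX) (ℚP.<⇒≤ 0<ϕ)
    B-large X-regular X-expander L-deg≥ L-deg≤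
  instance
    5α>0 : ℚ.Positive (5ℚ ℚ.* α)
    5α>0 = ℚP.pos*pos⇒pos 5ℚ α {{ℚ.positive (ℚP.<-≤-trans (ℚP.positive⁻¹ 1ℚ) 1≤α)}}
  vol≥1 : ∀ S → 0 ℕ.< count S → 1 ≤ vol E S
  vol≥1 S |S|>0 = ℕP.≤-trans |S|>0 (count≤vol E deg≥1 S)
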